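{- Let $G$ be a $P_5$-free graph and let $(X,Z)$ be a cradle in $G$. Then: (i) for all distinct vertices $x,x'\in X$ and distinct vertices $z,z'\in Z$, the edge set of $G[\{x,x',z,z'\}]$ is not equal to $\{xz,x'z'\}$; (ii) for every vertex $z\in Z$, there is at most one connected component of $G[X]$ in which $z$ has both a neighbour and a non-neighbour.
   Context: All graphs are finite and simple; $P_5$ is the path on five vertices and $G$ is $P_5$-free if no induced subgraph is isomorphic to $P_5$. For $X\subseteq V(G)$, $N(X)$ is the set of vertices of $V(G)\setminus X$ with a neighbour in $X$, $N[X]=N(X)\cup X$, and for $Z\subseteq V(G)$, $N_Z(X)=N(X)\cap Z$. A cradle in $G$ is a pair $(X,Z)$ of disjoint subsets of $V(G)$ such that either $|X|\leq 1$, or both: every vertex in $N_Z(X)$ has a neighbour in $V(G)\setminus N[X]$; and for every two vertices $z,z'\in N_Z(X)$ there is an induced path $P$ in $G$ from $z$ to $z'$ all of whose interior vertices lie in $V(G)\setminus N[X]$. -}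

module Defs where

open import Data.Nat using (ℕ; zero; suc)
open import Data.Fin using (Fin; toℕ; fromℕ)
open import Data.Fin.Subset using (Subset; _∈_; _∉_; ∣_∣)
open import Data.Product using (Σ; ∃; _×_; _,_)
open import Data.Sum using (_⊎_)
open import Data.Nat using (_≤_)
open import Relation.Nullary using (¬_; Dec)
open import Relation.Binary.PropositionalEquality using (_≡_; _≢_)
open import Function using (_⇔_)
open import Function.Definitions using (Injective)

record Graph : Set₁ where
  field
    n     : ℕ
    Adj   : Fin n → Fin n → Set
    sym   : ∀ {u v} → Adj u v → Adj v u
    irr   : ∀ {u} → ¬ Adj u u
    dec   : ∀ u v → Dec (Adj u v)

open Graph public

V : Graph → Set
V G = Fin (n G)

IsInducedPath : (G : Graph) (k : ℕ) → (Fin (suc k) → V G) → Set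
IsInducedPath G k f =
  Injective _≡_ _≡_ f ×
  (∀ i j → Adj G (f i) (f j) ⇔ (toℕ i ≡ suc (toℕ j) ⊎ toℕ j ≡ suc (toℕ i)))

P5Free : Graph → Set
P5Free G = ∀ (f : Fin 5 → V G) → ¬ IsInducedPath G 4 f

InN : (G : Graph) → Subset (n G) → V G → Set
InN G X v = v ∉ X × ∃ λ x → x ∈ X × Adj G v x

InNClosed : (G : Graph) → Subset (n G) → V G → Set
InNClosed G X v = v ∈ X ⊎ InN G X v

InNZ : (G : Graph) → Subset (n G) → Subset (n G) → V G → Set
InNZ G X Z v = InN G X v × v ∈ Z

Disjoint : ∀ {m} → Subset m → Subset m → Set
Disjoint X Z = ∀ v → v ∈ X → v ∉ Z

PathAvoiding : (G : Graph) → Subset (n G) → V G → V G → Set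
PathAvoiding G X z z' =
  Σ ℕ λ k → Σ (Fin (suc k) → V G) λ f →
    IsInducedPath G k f × f Fin.zero ≡ z × f (fromℕ k) ≡ z' ×
    (∀ i → toℕ i ≢ 0 → toℕ i ≢ k → ¬ InNClosed G X (f i))

Cradle : (G : Graph) → Subset (n G) → Subset (n G) → Set
Cradle G X Z =
  Disjoint X Z ×
  (∣ X ∣ ≤ 1 ⊎
    ((∀ z → InNZ G X Z z → ∃ λ w → ¬ InNClosed G X w × Adj G z w) ×
     (∀ z z' → InNZ G X Z z → InNZ G X Z z' → PathAvoiding G X z z')))

-- u and v lie in the same connected component of G[X]
-- (walk inside X; both endpoints in X).
data ConnIn (G : Graph) (X : Subset (n G)) : V G → V G → Set where
  here : ∀ {u} → u ∈ X → ConnIn G X u u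
  step : ∀ {u v w} → u ∈ X → Adj G u v → ConnIn G X v w → ConnIn G X u w

{-# OPTIONS --safe #-}
-- Both parts produce an induced P5. (i) The cradle supplies an induced path from z to z'
-- whose interior misses N[X]; prefixing x to it (and, if it has only three vertices,
-- appending x') gives an induced P5. (ii) Along a walk in G[X] from a neighbour to a
-- non-neighbour of z there is an edge a₁b₁ with z adjacent to a₁ but not b₁; two such edges
-- a₁b₁, c₁d₁ in different components give the induced P5 b₁ a₁ z c₁ d₁. So (ii) holds for
-- every vertex z, and (i) does not need z ≠ z'.
module Submission where

open import Defs
open import Data.Empty using (⊥; ⊥-elim)
open import Data.Fin using (Fin; toℕ)
open import Data.Fin.Patterns using (0F; 1F; 2F; 3F; 4F)
open import Data.Fin.Subset using (Subset; _∈_; _∉_; _⊆_; ∣_∣; ⁅_⁆)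
open import Data.Fin.Subset.Properties using (x∈⁅y⁆⇒x≡y; ∣⁅x⁆∣≡1; p⊂q⇒∣p∣<∣q∣)
open import Data.Nat as ℕ using (ℕ; suc; _≤_)
open import Data.Nat.Properties using (<⇒≱)
open import Data.Product using (_×_; _,_; proj₂)
open import Data.Sum using (_⊎_; inj₁; inj₂)
open import Function using (_⇔_; mk⇔; Equivalence; _∘_; const)
open import Function.Definitions using (Injective)
open import Relation.Nullary using (¬_; Dec; yes; no)
open import Relation.Nullary.Decidable using (_⊎-dec_; True; False; toWitness; toWitnessFalse)
open import Relation.Binary.PropositionalEquality as ≡ using (_≡_; _≢_; ≢-sym; refl; subst)

adj⇒≢ : (G : Graph) → ∀ {u v} → Adj G u v → u ≢ v
adj⇒≢ G uv refl = irr G uv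

Consecutive : ∀ {k} → Fin k → Fin k → Set
Consecutive i j = toℕ i ≡ suc (toℕ j) ⊎ toℕ j ≡ suc (toℕ i)

consecutive? : ∀ {k} (i j : Fin k) → Dec (Consecutive i j)
consecutive? i j = (toℕ i ℕ.≟ suc (toℕ j)) ⊎-dec (toℕ j ℕ.≟ suc (toℕ i))

-- The six distinctness conditions of an induced P5 follow from its edges and non-edges.
module _ (G : Graph) {v₀ v₁ v₂ v₃ v₄ : V G}
         (e₀₁ : Adj G v₀ v₁) (e₁₂ : Adj G v₁ v₂) (e₂₃ : Adj G v₂ v₃) (e₃₄ : Adj G v₃ v₄)
         (n₀₂ : ¬ Adj G v₀ v₂) (n₀₃ : ¬ Adj G v₀ v₃) (n₀₄ : ¬ Adj G v₀ v₄)
         (n₁₃ : ¬ Adj G v₁ v₃) (n₁₄ : ¬ Adj G v₁ v₄) (n₂₄ : ¬ Adj G v₂ v₄) where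

  private
    path : Fin 5 → V G
    path 0F = v₀
    path 1F = v₁
    path 2F = v₂
    path 3F = v₃
    path 4F = v₄

    v₀≢v₁ : v₀ ≢ v₁
    v₀≢v₁ = adj⇒≢ G e₀₁

    v₁≢v₂ : v₁ ≢ v₂
    v₁≢v₂ = adj⇒≢ G e₁₂

    v₂≢v₃ : v₂ ≢ v₃
    v₂≢v₃ = adj⇒≢ G e₂₃

    v₃≢v₄ : v₃ ≢ v₄
    v₃≢v₄ = adj⇒≢ G e₃₄

    v₀≢v₂ : v₀ ≢ v₂
    v₀≢v₂ refl = n₀₃ e₂₃

    v₀≢v₃ : v₀ ≢ v₃
    v₀≢v₃ refl = n₀₂ (sym G e₂₃)

    v₀≢v₄ : v₀ ≢ v₄
    v₀≢v₄ refl = n₀₃ (sym G e₃₄)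

    v₁≢v₃ : v₁ ≢ v₃
    v₁≢v₃ refl = n₁₄ e₃₄

    v₁≢v₄ : v₁ ≢ v₄
    v₁≢v₄ refl = n₁₃ (sym G e₃₄)

    v₂≢v₄ : v₂ ≢ v₄
    v₂≢v₄ refl = n₁₄ e₁₂

    injective : Injective _≡_ _≡_ path
    injective {0F} {0F} _ = refl
    injective {0F} {1F} e = ⊥-elim (v₀≢v₁ e)
    injective {0F} {2F} e = ⊥-elim (v₀≢v₂ e)
    injective {0F} {3F} e = ⊥-elim (v₀≢v₃ e)
    injective {0F} {4F} e = ⊥-elim (v₀≢v₄ e)
    injective {1F} {0F} e = ⊥-elim (≢-sym v₀≢v₁ e)
    injective {1F} {1F} _ = refl
    injective {1F} {2F} e = ⊥-elim (v₁≢v₂ e)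
    injective {1F} {3F} e = ⊥-elim (v₁≢v₃ e)
    injective {1F} {4F} e = ⊥-elim (v₁≢v₄ e)
    injective {2F} {0F} e = ⊥-elim (≢-sym v₀≢v₂ e)
    injective {2F} {1F} e = ⊥-elim (≢-sym v₁≢v₂ e)
    injective {2F} {2F} _ = refl
    injective {2F} {3F} e = ⊥-elim (v₂≢v₃ e)
    injective {2F} {4F} e = ⊥-elim (v₂≢v₄ e)
    injective {3F} {0F} e = ⊥-elim (≢-sym v₀≢v₃ e)
    injective {3F} {1F} e = ⊥-elim (≢-sym v₁≢v₃ e)
    injective {3F} {2F} e = ⊥-elim (≢-sym v₂≢v₃ e)
    injective {3F} {3F} _ = refl
    injective {3F} {4F} e = ⊥-elim (v₃≢v₄ e)
    injective {4F} {0F} e = ⊥-elim (≢-sym v₀≢v₄ e)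
    injective {4F} {1F} e = ⊥-elim (≢-sym v₁≢v₄ e)
    injective {4F} {2F} e = ⊥-elim (≢-sym v₂≢v₄ e)
    injective {4F} {3F} e = ⊥-elim (≢-sym v₃≢v₄ e)
    injective {4F} {4F} _ = refl

    linked : ∀ i j {_ : True (consecutive? i j)} →
             Adj G (path i) (path j) → Adj G (path i) (path j) ⇔ Consecutive i j
    linked i j {c} a = mk⇔ (const (toWitness c)) (const a)

    unlinked : ∀ i j {_ : False (consecutive? i j)} →
               ¬ Adj G (path i) (path j) → Adj G (path i) (path j) ⇔ Consecutive i j
    unlinked i j {c} n = mk⇔ (⊥-elim ∘ n) (⊥-elim ∘ toWitnessFalse c)

    adjacency : ∀ i j → Adj G (path i) (path j) ⇔ Consecutive i j
    adjacency 0F 0F = unlinked 0F 0F (irr G)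
    adjacency 0F 1F = linked   0F 1F e₀₁
    adjacency 0F 2F = unlinked 0F 2F n₀₂
    adjacency 0F 3F = unlinked 0F 3F n₀₃
    adjacency 0F 4F = unlinked 0F 4F n₀₄
    adjacency 1F 0F = linked   1F 0F (sym G e₀₁)
    adjacency 1F 1F = unlinked 1F 1F (irr G)
    adjacency 1F 2F = linked   1F 2F e₁₂
    adjacency 1F 3F = unlinked 1F 3F n₁₃
    adjacency 1F 4F = unlinked 1F 4F n₁₄
    adjacency 2F 0F = unlinked 2F 0F (n₀₂ ∘ sym G)
    adjacency 2F 1F = linked   2F 1F (sym G e₁₂)
    adjacency 2F 2F = unlinked 2F 2F (irr G)
    adjacency 2F 3F = linked   2F 3F e₂₃
    adjacency 2F 4F = unlinked 2F 4F n₂₄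
    adjacency 3F 0F = unlinked 3F 0F (n₀₃ ∘ sym G)
    adjacency 3F 1F = unlinked 3F 1F (n₁₃ ∘ sym G)
    adjacency 3F 2F = linked   3F 2F (sym G e₂₃)
    adjacency 3F 3F = unlinked 3F 3F (irr G)
    adjacency 3F 4F = linked   3F 4F e₃₄
    adjacency 4F 0F = unlinked 4F 0F (n₀₄ ∘ sym G)
    adjacency 4F 1F = unlinked 4F 1F (n₁₄ ∘ sym G)
    adjacency 4F 2F = unlinked 4F 2F (n₂₄ ∘ sym G)
    adjacency 4F 3F = linked   4F 3F (sym G e₃₄)
    adjacency 4F 4F = unlinked 4F 4F (irr G)

  P5Free⇒¬P5 : P5Free G → ⊥
  P5Free⇒¬P5 p5-free = p5-free path (injective , adjacency)

module InducedPath (G : Graph) {k : ℕ} {f : Fin (suc k) → V G} (induced : IsInducedPath G k f) where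

  edge : ∀ i j → toℕ j ≡ suc (toℕ i) → Adj G (f i) (f j)
  edge i j j≡1+i = Equivalence.from (proj₂ induced i j) (inj₂ j≡1+i)

  non-edge : ∀ i j → toℕ i ≢ suc (toℕ j) → toℕ j ≢ suc (toℕ i) → ¬ Adj G (f i) (f j)
  non-edge i j i≢1+j j≢1+i ij with Equivalence.to (proj₂ induced i j) ij
  ... | inj₁ i≡1+j = i≢1+j i≡1+j
  ... | inj₂ j≡1+i = j≢1+i j≡1+i

P5Free⇒¬P4-extension : (G : Graph) → P5Free G →
  ∀ {m} {f : Fin (suc (suc (suc (suc m)))) → V G} → IsInducedPath G (suc (suc (suc m))) f →
  ∀ {x} → Adj G x (f 0F) → ¬ Adj G x (f 1F) → ¬ Adj G x (f 2F) → ¬ Adj G x (f 3F) → ⊥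
P5Free⇒¬P4-extension G p5-free induced x₀ x≁₁ x≁₂ x≁₃ =
  P5Free⇒¬P5 G x₀ (edge 0F 1F refl) (edge 1F 2F refl) (edge 2F 3F refl) x≁₁ x≁₂ x≁₃
    (non-edge 0F 2F (λ ()) (λ ())) (non-edge 0F 3F (λ ()) (λ ())) (non-edge 1F 3F (λ ()) (λ ()))
    p5-free
  where open InducedPath G induced

∉N[X]⇒¬adj : (G : Graph) (X : Subset (n G)) {x v : V G} →
             x ∈ X → ¬ InNClosed G X v → ¬ Adj G x v
∉N[X]⇒¬adj G X x∈X v∉N[X] xv = v∉N[X] (inj₂ (v∉N[X] ∘ inj₁ , _ , x∈X , sym G xv))

avoiding-path⇒¬crossing : (G : Graph) → P5Free G → (X : Subset (n G)) →
  ∀ {x x' z z'} → x ∈ X → x' ∈ X →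
  Adj G x z → Adj G x' z' → ¬ Adj G x x' → ¬ Adj G z z' → ¬ Adj G x z' → ¬ Adj G x' z →
  ¬ PathAvoiding G X z z'
avoiding-path⇒¬crossing G p5-free X x∈X x'∈X xz x'z' x≁x' z≁z' x≁z' x'≁z
  (0 , _ , _ , refl , refl , _) = x'≁z x'z'
avoiding-path⇒¬crossing G p5-free X x∈X x'∈X xz x'z' x≁x' z≁z' x≁z' x'≁z
  (1 , _ , induced , refl , refl , _) = z≁z' (edge 0F 1F refl)
  where open InducedPath G induced
avoiding-path⇒¬crossing G p5-free X x∈X x'∈X xz x'z' x≁x' z≁z' x≁z' x'≁z
  (2 , f , induced , refl , refl , interior) =
  P5Free⇒¬P5 G xz (edge 0F 1F refl) (edge 1F 2F refl) (sym G x'z')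
    x≁p₁ x≁z' x≁x' z≁z' (x'≁z ∘ sym G) (x'≁p₁ ∘ sym G) p5-free
  where
  open InducedPath G induced
  p₁∉N[X] : ¬ InNClosed G X (f 1F)
  p₁∉N[X] = interior 1F (λ ()) (λ ())
  x≁p₁ : ¬ Adj G _ (f 1F)
  x≁p₁ = ∉N[X]⇒¬adj G X x∈X p₁∉N[X]
  x'≁p₁ : ¬ Adj G _ (f 1F)
  x'≁p₁ = ∉N[X]⇒¬adj G X x'∈X p₁∉N[X]
avoiding-path⇒¬crossing G p5-free X x∈X x'∈X xz x'z' x≁x' z≁z' x≁z' x'≁z
  (3 , _ , induced , refl , refl , interior) =
  P5Free⇒¬P4-extension G p5-free induced xz
    (∉N[X]⇒¬adj G X x∈X (interior 1F (λ ()) (λ ())))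
    (∉N[X]⇒¬adj G X x∈X (interior 2F (λ ()) (λ ())))
    x≁z'
avoiding-path⇒¬crossing G p5-free X x∈X x'∈X xz x'z' x≁x' z≁z' x≁z' x'≁z
  (suc (suc (suc (suc _))) , _ , induced , refl , refl , interior) =
  P5Free⇒¬P4-extension G p5-free induced xz
    (∉N[X]⇒¬adj G X x∈X (interior 1F (λ ()) (λ ())))
    (∉N[X]⇒¬adj G X x∈X (interior 2F (λ ()) (λ ())))
    (∉N[X]⇒¬adj G X x∈X (interior 3F (λ ()) (λ ())))

module _ (G : Graph) (X : Subset (n G)) where

  ConnIn-source : ∀ {a b} → ConnIn G X a b → a ∈ X
  ConnIn-source (here a∈X)     = a∈X
  ConnIn-source (step a∈X _ _) = a∈X

  ConnIn-target : ∀ {a b} → ConnIn G X a b → b ∈ X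
  ConnIn-target (here a∈X)     = a∈X
  ConnIn-target (step _ _ a⇝b) = ConnIn-target a⇝b

  ConnIn-trans : ∀ {a b c} → ConnIn G X a b → ConnIn G X b c → ConnIn G X a c
  ConnIn-trans (here _)          b⇝c = b⇝c
  ConnIn-trans (step a∈X ab a⇝b) b⇝c = step a∈X ab (ConnIn-trans a⇝b b⇝c)

  adj⇒ConnIn : ∀ {a b} → a ∈ X → b ∈ X → Adj G a b → ConnIn G X a b
  adj⇒ConnIn a∈X b∈X ab = step a∈X ab (here b∈X)

  ConnIn-sym : ∀ {a b} → ConnIn G X a b → ConnIn G X b a
  ConnIn-sym (here a∈X)        = here a∈X
  ConnIn-sym (step a∈X ab b⇝c) =
    ConnIn-trans (ConnIn-sym b⇝c) (adj⇒ConnIn (ConnIn-source b⇝c) a∈X (sym G ab))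

  record BoundaryEdge (z a : V G) : Set where
    field
      {a₁ b₁} : V G
      a⇝a₁    : ConnIn G X a a₁
      b₁∈X    : b₁ ∈ X
      a₁b₁    : Adj G a₁ b₁
      za₁     : Adj G z a₁
      z≁b₁    : ¬ Adj G z b₁

  boundary-edge : ∀ {z a b} → Adj G z a → ¬ Adj G z b → ConnIn G X a b → BoundaryEdge z a
  boundary-edge za z≁b (here _) = ⊥-elim (z≁b za)
  boundary-edge {z} za z≁b (step {v = v} a∈X av v⇝b) with dec G z v
  ... | yes zv = record
    { a⇝a₁ = step a∈X av a⇝a₁ ; b₁∈X = b₁∈X ; a₁b₁ = a₁b₁ ; za₁ = za₁ ; z≁b₁ = z≁b₁ }
    where open BoundaryEdge (boundary-edge zv z≁b v⇝b)
  ... | no z≁v = record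
    { a⇝a₁ = here a∈X ; b₁∈X = ConnIn-source v⇝b ; a₁b₁ = av ; za₁ = za ; z≁b₁ = z≁v }

  boundary-edges-connected : P5Free G → ∀ {z a c} →
                             BoundaryEdge z a → BoundaryEdge z c → ConnIn G X a c
  boundary-edges-connected p5-free e f =
    ConnIn-trans E.a⇝a₁ (ConnIn-trans a₁⇝c₁ (ConnIn-sym F.a⇝a₁))
    where
    module E = BoundaryEdge e
    module F = BoundaryEdge f

    a₁⇝b₁ : ConnIn G X E.a₁ E.b₁
    a₁⇝b₁ = adj⇒ConnIn (ConnIn-target E.a⇝a₁) E.b₁∈X E.a₁b₁

    d₁⇝c₁ : ConnIn G X F.b₁ F.a₁
    d₁⇝c₁ = adj⇒ConnIn F.b₁∈X (ConnIn-target F.a⇝a₁) (sym G F.a₁b₁)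

    a₁⇝c₁ : ConnIn G X E.a₁ F.a₁
    a₁⇝c₁ with dec G E.a₁ F.a₁ | dec G E.a₁ F.b₁ | dec G E.b₁ F.a₁ | dec G E.b₁ F.b₁
    ... | yes a₁c₁ | _ | _ | _ = adj⇒ConnIn (ConnIn-target E.a⇝a₁) (ConnIn-target F.a⇝a₁) a₁c₁
    ... | _ | yes a₁d₁ | _ | _ =
      ConnIn-trans (adj⇒ConnIn (ConnIn-target E.a⇝a₁) F.b₁∈X a₁d₁) d₁⇝c₁
    ... | _ | _ | yes b₁c₁ | _ =
      ConnIn-trans a₁⇝b₁ (adj⇒ConnIn E.b₁∈X (ConnIn-target F.a⇝a₁) b₁c₁)
    ... | _ | _ | _ | yes b₁d₁ =
      ConnIn-trans a₁⇝b₁ (ConnIn-trans (adj⇒ConnIn E.b₁∈X F.b₁∈X b₁d₁) d₁⇝c₁)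
    ... | no a₁≁c₁ | no a₁≁d₁ | no b₁≁c₁ | no b₁≁d₁ =
      ⊥-elim (P5Free⇒¬P5 G (sym G E.a₁b₁) (sym G E.za₁) F.za₁ F.a₁b₁
                (E.z≁b₁ ∘ sym G) b₁≁c₁ b₁≁d₁ a₁≁c₁ a₁≁d₁ F.z≁b₁ p5-free)

  at-most-one-mixed-component : P5Free G → ∀ {z a b c d} →
    Adj G z a → ¬ Adj G z b → ConnIn G X a b →
    Adj G z c → ¬ Adj G z d → ConnIn G X c d →
    ConnIn G X a c
  at-most-one-mixed-component p5-free za z≁b a⇝b zc z≁d c⇝d =
    boundary-edges-connected p5-free (boundary-edge za z≁b a⇝b) (boundary-edge zc z≁d c⇝d)

two-members⇒2≤∣p∣ : ∀ {m} {p : Subset m} {x y} → x ∈ p → y ∈ p → x ≢ y → 2 ≤ ∣ p ∣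
two-members⇒2≤∣p∣ {p = p} {x} {y} x∈p y∈p x≢y =
  subst (λ k → suc k ≤ ∣ p ∣) (∣⁅x⁆∣≡1 x) (p⊂q⇒∣p∣<∣q∣ (⁅x⁆⊆p , y , y∈p , y∉⁅x⁆))
  where
  ⁅x⁆⊆p : ⁅ x ⁆ ⊆ p
  ⁅x⁆⊆p v∈⁅x⁆ = subst (_∈ p) (≡.sym (x∈⁅y⁆⇒x≡y x v∈⁅x⁆)) x∈p
  y∉⁅x⁆ : y ∉ ⁅ x ⁆
  y∉⁅x⁆ = x≢y ∘ ≡.sym ∘ x∈⁅y⁆⇒x≡y x

adj⇒∈N_Z : (G : Graph) (X Z : Subset (n G)) → Disjoint X Z →
           ∀ {x z} → x ∈ X → z ∈ Z → Adj G x z → InNZ G X Z z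
adj⇒∈N_Z G X Z X∩Z≡∅ x∈X z∈Z xz = ((λ z∈X → X∩Z≡∅ _ z∈X z∈Z) , _ , x∈X , sym G xz) , z∈Z

cradle⇒¬crossing : (G : Graph) → P5Free G → (X Z : Subset (n G)) → Cradle G X Z →
  ∀ {x x' z z'} → x ∈ X → x' ∈ X → x ≢ x' → z ∈ Z → z' ∈ Z →
  Adj G x z → Adj G x' z' → ¬ Adj G x x' → ¬ Adj G z z' → ¬ Adj G x z' → ¬ Adj G x' z → ⊥
cradle⇒¬crossing G p5-free X Z (_ , inj₁ ∣X∣≤1) x∈X x'∈X x≢x' _ _ _ _ _ _ _ _ =
  <⇒≱ (two-members⇒2≤∣p∣ x∈X x'∈X x≢x') ∣X∣≤1
cradle⇒¬crossing G p5-free X Z (X∩Z≡∅ , inj₂ (_ , avoiding-path))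
  x∈X x'∈X _ z∈Z z'∈Z xz x'z' x≁x' z≁z' x≁z' x'≁z =
  avoiding-path⇒¬crossing G p5-free X x∈X x'∈X xz x'z' x≁x' z≁z' x≁z' x'≁z
    (avoiding-path _ _ (adj⇒∈N_Z G X Z X∩Z≡∅ x∈X z∈Z xz) (adj⇒∈N_Z G X Z X∩Z≡∅ x'∈X z'∈Z x'z'))

lemma3p1 : (G : Graph) → P5Free G → (X Z : Subset (n G)) → Cradle G X Z →
    (∀ x x' z z' → x ∈ X → x' ∈ X → x ≢ x' → z ∈ Z → z' ∈ Z → z ≢ z' →
      ¬ (Adj G x z × Adj G x' z' × ¬ Adj G x x' × ¬ Adj G z z' ×
         ¬ Adj G x z' × ¬ Adj G x' z))
    ×
    (∀ z → z ∈ Z → ∀ a b c d →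
      Adj G z a → ¬ Adj G z b → ConnIn G X a b →
      Adj G z c → ¬ Adj G z d → ConnIn G X c d →
      ConnIn G X a c)
lemma3p1 G p5-free X Z cradle =
  (λ { _ _ _ _ x∈X x'∈X x≢x' z∈Z z'∈Z _ (xz , x'z' , x≁x' , z≁z' , x≁z' , x'≁z) →
         cradle⇒¬crossing G p5-free X Z cradle x∈X x'∈X x≢x' z∈Z z'∈Z
           xz x'z' x≁x' z≁z' x≁z' x'≁z }) ,
  (λ _ _ _ _ _ _ → at-most-one-mixed-component G X p5-free)
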